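{- Let $G$ and $H$ be connected graphs with at least two vertices, of orders $n_1$ and $n_2$ respectively. Then $$\max\{n_2\cdot dim_s(G),\,n_1\cdot dim_s(H)\}\le dim_s(G\boxtimes H)\le n_2\cdot dim_s(G)+n_1\cdot dim_s(H)-dim_s(G)\cdot dim_s(H).$$
   Context: All graphs are finite and simple; $d_G$ is the shortest-path distance. A vertex $w$ strongly resolves vertices $u,v$ if $d_G(w,u)=d_G(w,v)+d_G(v,u)$ or $d_G(w,v)=d_G(w,u)+d_G(u,v)$. A set $S\subseteq V(G)$ is a strong metric generator if every pair of vertices of $G$ is strongly resolved by some vertex of $S$; $dim_s(G)$, the strong metric dimension, is the minimum cardinality of a strong metric generator. The strong product $G\boxtimes H$ has vertex set $V(G)\times V(H)$, with $(a,b)\sim(c,d)$ iff ($a=c$ and $bd\in E(H)$) or ($ac\in E(G)$ and $b=d$) or ($ac\in E(G)$ and $bd\in E(H)$). -}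

module Defs where

open import Data.Nat using (ℕ; zero; suc; _≤_; _+_; _*_)
open import Data.Fin using (Fin; remQuot)
open import Data.Fin.Subset using (Subset; _∈_; ∣_∣)
open import Data.Product using (_×_; _,_; proj₁; proj₂; ∃; ∃-syntax; Σ-syntax)
open import Data.Sum using (_⊎_; inj₁; inj₂)
open import Relation.Binary.PropositionalEquality using (_≡_; _≢_; refl; sym)
open import Relation.Nullary using (¬_)

record Graph (n : ℕ) : Set₁ where
  field
    Adj   : Fin n → Fin n → Set
    adj-sym : ∀ {u v} → Adj u v → Adj v u
    adj-irrefl : ∀ {u} → ¬ Adj u u
open Graph public

data Walk {n : ℕ} (G : Graph n) : Fin n → Fin n → ℕ → Set where
  nil  : ∀ {u} → Walk G u u zero
  cons : ∀ {u w v k} → Adj G u w → Walk G w v k → Walk G u v (suc k)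

Connected : ∀ {n} → Graph n → Set
Connected G = ∀ u v → ∃[ k ] Walk G u v k

IsDist : ∀ {n} → Graph n → Fin n → Fin n → ℕ → Set
IsDist G u v d = Walk G u v d × (∀ m → Walk G u v m → d ≤ m)

StronglyResolves : ∀ {n} → Graph n → Fin n → Fin n → Fin n → Set
StronglyResolves G w u v =
  Σ[ dwu ∈ ℕ ] Σ[ dwv ∈ ℕ ] Σ[ duv ∈ ℕ ] Σ[ dvu ∈ ℕ ]
    (IsDist G w u dwu × IsDist G w v dwv × IsDist G u v duv × IsDist G v u dvu ×
     ((dwu ≡ dwv + dvu) ⊎ (dwv ≡ dwu + duv)))

IsStrongMetricGenerator : ∀ {n} → Graph n → Subset n → Set
IsStrongMetricGenerator G S =
  ∀ u v → u ≢ v → ∃[ w ] (w ∈ S × StronglyResolves G w u v)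

IsStrongMetricDim : ∀ {n} → Graph n → ℕ → Set
IsStrongMetricDim G k =
  (∃[ S ] (IsStrongMetricGenerator G S × ∣ S ∣ ≡ k)) ×
  (∀ S → IsStrongMetricGenerator G S → k ≤ ∣ S ∣)

StrongAdj : ∀ {n₁ n₂} → Graph n₁ → Graph n₂ → Fin (n₁ * n₂) → Fin (n₁ * n₂) → Set
StrongAdj {n₁} {n₂} G H x y with remQuot {n₁} n₂ x | remQuot {n₁} n₂ y
... | (a , b) | (c , d) =
  (a ≡ c × Adj H b d) ⊎ (Adj G a c × b ≡ d) ⊎ (Adj G a c × Adj H b d)

private
  strongSym : ∀ {n₁ n₂} (G : Graph n₁) (H : Graph n₂) {x y} →
              StrongAdj G H x y → StrongAdj G H y x
  strongSym {n₁} {n₂} G H {x} {y} p with remQuot {n₁} n₂ x | remQuot {n₁} n₂ y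
  ... | (a , b) | (c , d) with p
  ... | inj₁ (e , h) = inj₁ (sym e , Graph.adj-sym H h)
  ... | inj₂ (inj₁ (g , e)) = inj₂ (inj₁ (Graph.adj-sym G g , sym e))
  ... | inj₂ (inj₂ (g , h)) = inj₂ (inj₂ (Graph.adj-sym G g , Graph.adj-sym H h))

  strongIrr : ∀ {n₁ n₂} (G : Graph n₁) (H : Graph n₂) {x} → ¬ StrongAdj G H x x
  strongIrr {n₁} {n₂} G H {x} p with remQuot {n₁} n₂ x
  ... | (a , b) with p
  ... | inj₁ (_ , h) = Graph.adj-irrefl H h
  ... | inj₂ (inj₁ (g , _)) = Graph.adj-irrefl G g
  ... | inj₂ (inj₂ (g , _)) = Graph.adj-irrefl G g

_⊠_ : ∀ {n₁ n₂} → Graph n₁ → Graph n₂ → Graph (n₁ * n₂)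
G ⊠ H = record { Adj = StrongAdj G H ; adj-sym = strongSym G H ; adj-irrefl = strongIrr G H }

-- In G ⊠ H the distance is d((a,b),(c,e)) = max(d(a,c), d(b,e)). If S₁ and S₂ are strong metric
-- generators of G and H, then (S₁ × V(H)) ∪ (V(G) × S₂) is one of G ⊠ H: a pair is resolved through
-- the factor in which it is farther apart; counting gives n₂|S₁| + n₁|S₂| − |S₁||S₂| elements.
-- Conversely, if W generates G ⊠ H, each slice {a | (a,b) ∈ W} generates G: a mutually maximally
-- distant pair a, c of G yields the mutually maximally distant pair (a,b), (c,b), which only its own
-- endpoints resolve, and resolution of such pairs spreads to all pairs. Summing over b gives n₂ dim_s(G).
module Submission where

open import Defs
open import Data.Nat.Properties
open import Algebra.Properties.Semiring.Sum +-*-semiring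
  using (sum; sum-syntax; sum-cong-≗; ∑-distrib-+; ∑-comm; *-distribˡ-sum; *-distribʳ-sum)
open import Data.Bool using (Bool; true; false; _∨_)
open import Data.Bool.Properties using (∨-zeroʳ)
open import Data.Empty using (⊥-elim)
open import Data.Fin using (Fin; zero; suc; _↑ˡ_; _↑ʳ_; combine; remQuot)
open import Data.Fin.Properties using (any?; remQuot-combine; combine-remQuot)
open import Data.Fin.Subset using (Subset; _∈_; ∣_∣)
open import Data.Nat using (ℕ; zero; suc; _≤_; _+_; _*_; _∸_; _⊔_; z≤n; s≤s; s≤s⁻¹; _≟_)
open import Data.Product using (_×_; _,_; proj₁; proj₂; Σ; ∃; ∃-syntax)
open import Data.Sum using (_⊎_; inj₁; inj₂)
import Data.Sum as Sum
open import Data.Vec using ([]; _∷_; lookup; tabulate)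
open import Data.Vec.Properties using (lookup∘tabulate; []=⇒lookup; lookup⇒[]=)
open import Function using (_∘_)
open import Relation.Binary.PropositionalEquality
open import Relation.Nullary using (¬_; Dec; yes; no)
open import Relation.Nullary.Decidable using (_×-dec_)

∑-const : ∀ n k → ∑[ i < n ] k ≡ n * k
∑-const zero    k = refl
∑-const (suc n) k = cong (k +_) (∑-const n k)

∑-mono-≤ : ∀ {n} {f g : Fin n → ℕ} → (∀ i → f i ≤ g i) → sum f ≤ sum g
∑-mono-≤ {zero}  f≤g = z≤n
∑-mono-≤ {suc n} f≤g = +-mono-≤ (f≤g zero) (∑-mono-≤ (f≤g ∘ suc))

term≤∑ : ∀ {n} (f : Fin n → ℕ) i → f i ≤ sum f
term≤∑ f zero    = m≤m+n _ _
term≤∑ f (suc i) = ≤-trans (term≤∑ (f ∘ suc) i) (m≤n+m _ _)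

∑-↑ : ∀ m {n} (f : Fin (m + n) → ℕ) →
      sum f ≡ ∑[ i < m ] f (i ↑ˡ n) + ∑[ j < n ] f (m ↑ʳ j)
∑-↑ zero    f = refl
∑-↑ (suc m) f = trans (cong (f zero +_) (∑-↑ m (f ∘ suc))) (sym (+-assoc (f zero) _ _))

∑-combine : ∀ m {n} (f : Fin (m * n) → ℕ) →
            sum f ≡ ∑[ i < m ] ∑[ j < n ] f (combine i j)
∑-combine zero    f = refl
∑-combine (suc m) {n} f =
  trans (∑-↑ n f) (cong (∑[ j < n ] f (j ↑ˡ (m * n)) +_) (∑-combine m (f ∘ (n ↑ʳ_))))

𝟙 : Bool → ℕ
𝟙 true  = 1
𝟙 false = 0

𝟙-∨ : ∀ x y → 𝟙 (x ∨ y) + 𝟙 x * 𝟙 y ≡ 𝟙 x + 𝟙 y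
𝟙-∨ true  true  = refl
𝟙-∨ true  false = refl
𝟙-∨ false true  = refl
𝟙-∨ false false = refl

∑∑-∨ : ∀ {m n} (p : Fin m → Bool) (q : Fin n → Bool) →
       ∑[ i < m ] ∑[ j < n ] 𝟙 (p i ∨ q j) + (∑[ i < m ] 𝟙 (p i)) * (∑[ j < n ] 𝟙 (q j))
       ≡ n * ∑[ i < m ] 𝟙 (p i) + m * ∑[ j < n ] 𝟙 (q j)
∑∑-∨ {m} {n} p q = begin
  ∑[ i < m ] ∑[ j < n ] 𝟙 (p i ∨ q j) + P * Q
    ≡⟨ cong (∑[ i < m ] ∑[ j < n ] 𝟙 (p i ∨ q j) +_) P*Q≡∑∑ ⟩
  ∑[ i < m ] ∑[ j < n ] 𝟙 (p i ∨ q j) + ∑[ i < m ] ∑[ j < n ] (𝟙 (p i) * 𝟙 (q j))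
    ≡⟨ sym (∑-distrib-+ (λ i → ∑[ j < n ] 𝟙 (p i ∨ q j)) _) ⟩
  ∑[ i < m ] (∑[ j < n ] 𝟙 (p i ∨ q j) + ∑[ j < n ] (𝟙 (p i) * 𝟙 (q j)))
    ≡⟨ sum-cong-≗ (λ i → sym (∑-distrib-+ (λ j → 𝟙 (p i ∨ q j)) _)) ⟩
  ∑[ i < m ] ∑[ j < n ] (𝟙 (p i ∨ q j) + 𝟙 (p i) * 𝟙 (q j))
    ≡⟨ sum-cong-≗ (λ i → sum-cong-≗ (λ j → 𝟙-∨ (p i) (q j))) ⟩
  ∑[ i < m ] ∑[ j < n ] (𝟙 (p i) + 𝟙 (q j))
    ≡⟨ sum-cong-≗ (λ i → trans (∑-distrib-+ {n} (λ _ → 𝟙 (p i)) (𝟙 ∘ q))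
                               (cong (_+ Q) (∑-const n (𝟙 (p i))))) ⟩
  ∑[ i < m ] (n * 𝟙 (p i) + Q)
    ≡⟨ ∑-distrib-+ (λ i → n * 𝟙 (p i)) _ ⟩
  ∑[ i < m ] (n * 𝟙 (p i)) + ∑[ i < m ] Q
    ≡⟨ cong₂ _+_ (sym (*-distribˡ-sum n (𝟙 ∘ p))) (∑-const m Q) ⟩
  n * P + m * Q ∎
  where
    open ≡-Reasoning
    P = ∑[ i < m ] 𝟙 (p i)
    Q = ∑[ j < n ] 𝟙 (q j)
    P*Q≡∑∑ : P * Q ≡ ∑[ i < m ] ∑[ j < n ] (𝟙 (p i) * 𝟙 (q j))
    P*Q≡∑∑ = trans (*-distribʳ-sum Q (𝟙 ∘ p)) (sum-cong-≗ (λ i → *-distribˡ-sum (𝟙 (p i)) (𝟙 ∘ q)))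

∣p∣≡∑𝟙 : ∀ {n} (p : Subset n) → ∣ p ∣ ≡ ∑[ i < n ] 𝟙 (lookup p i)
∣p∣≡∑𝟙 []          = refl
∣p∣≡∑𝟙 (true  ∷ p) = cong suc (∣p∣≡∑𝟙 p)
∣p∣≡∑𝟙 (false ∷ p) = ∣p∣≡∑𝟙 p

∣tabulate∣ : ∀ {n} (f : Fin n → Bool) → ∣ tabulate f ∣ ≡ ∑[ i < n ] 𝟙 (f i)
∣tabulate∣ f = trans (∣p∣≡∑𝟙 (tabulate f)) (sum-cong-≗ (cong 𝟙 ∘ lookup∘tabulate f))

∈-tabulate : ∀ {n} (f : Fin n → Bool) {i} → f i ≡ true → i ∈ tabulate f
∈-tabulate f {i} fi≡true = lookup⇒[]= i (tabulate f) (trans (lookup∘tabulate f i) fi≡true)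

-- Integer-valued metrics in which every distance can be walked in unit steps: graph metrics.
record Metric (V : Set) : Set where
  field
    d          : V → V → ℕ
    d-refl     : ∀ x → d x x ≡ 0
    d≡0⇒≡      : ∀ {x y} → d x y ≡ 0 → x ≡ y
    d-sym      : ∀ x y → d x y ≡ d y x
    d-triangle : ∀ x y z → d x z ≤ d x y + d y z
    d-step     : ∀ {x y k} → d x y ≡ suc k → ∃[ z ] (d x z ≡ 1 × d z y ≡ k)

module _ {V : Set} (M : Metric V) where
  open Metric M

  Between : V → V → V → Set
  Between w v u = d w u ≡ d w v + d v u

  Resolves : V → V → V → Set
  Resolves w u v = Between w v u ⊎ Between w u v

  IsResolvingSet : (V → Set) → Set
  IsResolvingSet S = ∀ u v → u ≢ v → ∃[ w ] (S w × Resolves w u v)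

  FartherNeighbour : V → V → V → Set
  FartherNeighbour c a a′ = d a a′ ≡ 1 × d a′ c ≡ suc (d a c)

  MaximallyDistant : V → V → Set
  MaximallyDistant u v = ∀ v′ → d v v′ ≡ 1 → d v′ u ≤ d v u

module MetricProperties {V : Set} (M : Metric V) where
  open Metric M

  ≢⇒1≤d : ∀ {x y} → x ≢ y → 1 ≤ d x y
  ≢⇒1≤d {x} {y} x≢y with d x y in e
  ... | zero  = ⊥-elim (x≢y (d≡0⇒≡ e))
  ... | suc _ = s≤s z≤n

  d≡suc⇒≢ : ∀ {x y k} → d x y ≡ suc k → x ≢ y
  d≡suc⇒≢ {x} e refl with () ← trans (sym e) (d-refl x)

  d≤1⇒≡⊎d≡1 : ∀ {x y} → d x y ≤ 1 → x ≡ y ⊎ d x y ≡ 1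
  d≤1⇒≡⊎d≡1 {x} {y} d≤1 with d x y in e | d≤1
  ... | zero        | _      = inj₁ (d≡0⇒≡ e)
  ... | suc zero    | _      = inj₂ refl
  ... | suc (suc _) | s≤s ()

  resolves-farther : ∀ {x a c a′} → FartherNeighbour M c a a′ →
                     Resolves M x a′ c → Resolves M x a c
  resolves-farther {x} {a} {c} {a′} (aa′≡1 , a′c≡1+ac) (inj₁ x-c-a′) =
    inj₁ (≤-antisym (d-triangle x c a) (+-cancelʳ-≤ 1 _ _ (begin
      d x c + d c a + 1   ≡⟨ +-assoc (d x c) (d c a) 1 ⟩
      d x c + (d c a + 1) ≡⟨ cong (d x c +_) (trans (+-comm (d c a) 1) (cong suc (d-sym c a))) ⟩
      d x c + suc (d a c) ≡⟨ cong (d x c +_) (trans (sym a′c≡1+ac) (d-sym a′ c)) ⟩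
      d x c + d c a′      ≡⟨ x-c-a′ ⟨
      d x a′              ≤⟨ d-triangle x a a′ ⟩
      d x a + d a a′      ≡⟨ cong (d x a +_) aa′≡1 ⟩
      d x a + 1           ∎)))
    where open ≤-Reasoning
  resolves-farther {x} {a} {c} {a′} (aa′≡1 , a′c≡1+ac) (inj₂ x-a′-c) =
    inj₂ (≤-antisym (d-triangle x a c) (begin
      d x a + d a c           ≤⟨ +-monoˡ-≤ (d a c) (d-triangle x a′ a) ⟩
      d x a′ + d a′ a + d a c ≡⟨ cong (λ t → d x a′ + t + d a c) (trans (d-sym a′ a) aa′≡1) ⟩
      d x a′ + 1 + d a c      ≡⟨ +-assoc (d x a′) 1 (d a c) ⟩
      d x a′ + suc (d a c)    ≡⟨ cong (d x a′ +_) a′c≡1+ac ⟨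
      d x a′ + d a′ c         ≡⟨ x-a′-c ⟨
      d x c                   ∎))
    where open ≤-Reasoning

  ¬farther⇒maximallyDistant : ∀ {a c} → ¬ ∃ (FartherNeighbour M c a) → MaximallyDistant M c a
  ¬farther⇒maximallyDistant {a} {c} ¬farther a′ aa′≡1 =
    s≤s⁻¹ (≤∧≢⇒< a′c≤1+ac (λ a′c≡1+ac → ¬farther (a′ , aa′≡1 , a′c≡1+ac)))
    where
      a′c≤1+ac : d a′ c ≤ suc (d a c)
      a′c≤1+ac = subst (λ t → d a′ c ≤ t + d a c) (trans (d-sym a′ a) aa′≡1) (d-triangle a′ a c)

  -- Otherwise the neighbour v′ of v towards w would satisfy d v′ u ≡ suc (d v u).
  between-maximallyDistant : ∀ {w u v} → MaximallyDistant M u v → Between M w v u → w ≡ v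
  between-maximallyDistant {w} {u} {v} maximal w-v-u with d v w in e
  ... | zero  = sym (d≡0⇒≡ e)
  ... | suc k with d-step e
  ... | v′ , vv′≡1 , v′w≡k = ⊥-elim (m+1+n≰m (k + d v u) (begin
    k + d v u + 1   ≡⟨ +-comm (k + d v u) 1 ⟩
    suc k + d v u   ≡⟨ cong (_+ d v u) (trans (sym e) (d-sym v w)) ⟩
    d w v + d v u   ≡⟨ w-v-u ⟨
    d w u           ≤⟨ d-triangle w v′ u ⟩
    d w v′ + d v′ u ≡⟨ cong (_+ d v′ u) (trans (d-sym w v′) v′w≡k) ⟩
    k + d v′ u      ≤⟨ +-monoʳ-≤ k (maximal v′ vv′≡1) ⟩
    k + d v u       ∎))
    where open ≤-Reasoning

module FiniteMetric {n : ℕ} (M : Metric (Fin n)) where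
  open Metric M
  open MetricProperties M

  diameter-bound : ℕ
  diameter-bound = ∑[ u < n ] ∑[ v < n ] d u v

  d≤diameter-bound : ∀ u v → d u v ≤ diameter-bound
  d≤diameter-bound u v = ≤-trans (term≤∑ (d u) v) (term≤∑ (λ u′ → ∑[ v′ < n ] d u′ v′) u)

  farther? : ∀ c a → Dec (∃ (FartherNeighbour M c a))
  farther? c a = any? (λ a′ → (d a a′ ≟ 1) ×-dec (d a′ c ≟ suc (d a c)))

  -- Move a (or c) to a farther neighbour while one exists. Each move increases d a c,
  -- which is bounded, so the process stops at a mutually maximally distant pair.
  module _ (P : Fin n → Fin n → Set)
           (P-sym : ∀ {a c} → P a c → P c a)
           (P-farther : ∀ {a c a′} → FartherNeighbour M c a a′ → P a′ c → P a c)
           (P-maximal : ∀ {a c} → a ≢ c → MaximallyDistant M c a → MaximallyDistant M a c → P a c)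
    where

    mutual
      walk-apart : ∀ k a c → diameter-bound ≤ d a c + k → a ≢ c → P a c
      walk-apart k a c bound a≢c with farther? c a | farther? a c
      ... | yes (_ , far) | _ = step k bound far
      ... | no _ | yes (_ , far) =
        P-sym (step k (subst (λ t → diameter-bound ≤ t + k) (d-sym a c) bound) far)
      ... | no ¬farA | no ¬farC =
        P-maximal a≢c (¬farther⇒maximallyDistant ¬farA) (¬farther⇒maximallyDistant ¬farC)

      step : ∀ k {a c a′} → diameter-bound ≤ d a c + k → FartherNeighbour M c a a′ → P a c
      step zero {a} {c} {a′} bound (_ , a′c≡1+ac) =
        ⊥-elim (n≮n (d a c) (begin-strict
          d a c              <⟨ n<1+n (d a c) ⟩
          suc (d a c)        ≡⟨ a′c≡1+ac ⟨
          d a′ c             ≤⟨ d≤diameter-bound a′ c ⟩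
          diameter-bound     ≤⟨ bound ⟩
          d a c + 0          ≡⟨ +-identityʳ (d a c) ⟩
          d a c              ∎))
        where open ≤-Reasoning
      step (suc k) {a} {c} {a′} bound far@(_ , a′c≡1+ac) =
        P-farther far (walk-apart k a′ c bound′ (d≡suc⇒≢ a′c≡1+ac))
        where
          bound′ : diameter-bound ≤ d a′ c + k
          bound′ = subst (diameter-bound ≤_) (trans (+-suc (d a c) k) (cong (_+ k) (sym a′c≡1+ac))) bound

    mutuallyMaximal-induction : ∀ a c → a ≢ c → P a c
    mutuallyMaximal-induction a c = walk-apart diameter-bound a c (m≤n+m diameter-bound (d a c))

HasDistances : ∀ {n} → Graph n → Set
HasDistances K = ∀ u v → Σ ℕ (IsDist K u v)

-- Resolving u ≢ v includes knowing d(u, v).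
isStrongMetricGenerator⇒hasDistances : ∀ {n} {K : Graph n} {S} →
                                       IsStrongMetricGenerator K S → HasDistances K
isStrongMetricGenerator⇒hasDistances gen u v with u Data.Fin.≟ v
... | yes refl = 0 , nil , λ _ _ → z≤n
... | no u≢v with gen u v u≢v
... | _ , _ , _ , _ , duv , _ , _ , _ , isDist , _ = duv , isDist

isDist-unique : ∀ {n} {K : Graph n} {u v p q} → IsDist K u v p → IsDist K u v q → p ≡ q
isDist-unique (walkp , minp) (walkq , minq) = ≤-antisym (minp _ walkq) (minq _ walkp)

module GraphMetric {n : ℕ} (K : Graph n) (dist : HasDistances K) where

  d : Fin n → Fin n → ℕ
  d u v = proj₁ (dist u v)

  shortest : ∀ u v → Walk K u v (d u v)
  shortest u v = proj₁ (proj₂ (dist u v))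

  d≤length : ∀ {u v m} → Walk K u v m → d u v ≤ m
  d≤length {u} {v} {m} = proj₂ (proj₂ (dist u v)) m

  _++ʷ_ : ∀ {u v w p q} → Walk K u v p → Walk K v w q → Walk K u w (p + q)
  nil      ++ʷ q = q
  cons h p ++ʷ q = cons h (p ++ʷ q)

  reverse-onto : ∀ {u v x k j} → Walk K u v k → Walk K u x j → Walk K v x (k + j)
  reverse-onto nil acc = acc
  reverse-onto {k = suc k} {j} (cons h p) acc =
    subst (Walk K _ _) (+-suc k j) (reverse-onto p (cons (adj-sym K h) acc))

  reverse : ∀ {u v k} → Walk K u v k → Walk K v u k
  reverse {k = k} p = subst (Walk K _ _) (+-identityʳ k) (reverse-onto p nil)

  d-sym : ∀ u v → d u v ≡ d v u
  d-sym u v = ≤-antisym (d≤length (reverse (shortest v u))) (d≤length (reverse (shortest u v)))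

  d-refl : ∀ u → d u u ≡ 0
  d-refl u = n≤0⇒n≡0 (d≤length {u} nil)

  d≡0⇒≡ : ∀ {u v} → d u v ≡ 0 → u ≡ v
  d≡0⇒≡ {u} {v} e = length0 (subst (Walk K u v) e (shortest u v))
    where
      length0 : ∀ {u v} → Walk K u v 0 → u ≡ v
      length0 nil = refl

  d-triangle : ∀ u v w → d u w ≤ d u v + d v w
  d-triangle u v w = d≤length (shortest u v ++ʷ shortest v w)

  adj⇒d≡1 : ∀ {u v} → Adj K u v → d u v ≡ 1
  adj⇒d≡1 {u} {v} h with d u v in e | d≤length {u} {v} (cons h nil)
  ... | zero        | _ = ⊥-elim (adj-irrefl K (subst (Adj K u) (sym (d≡0⇒≡ e)) h))
  ... | suc zero    | _ = refl
  ... | suc (suc _) | s≤s ()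

  towards : ∀ u v → ∃[ u′ ] ((u′ ≡ u × d u v ≡ 0 ⊎ Adj K u u′) × d u′ v ≡ d u v ∸ 1)
  towards u v with d u v in e | shortest u v
  ... | zero  | _                    = u , inj₁ (refl , refl) , e
  ... | suc k | cons {w = u′} h rest =
    u′ , inj₂ h , ≤-antisym (d≤length rest) (+-cancelˡ-≤ 1 _ _ (begin
      suc k           ≡⟨ e ⟨
      d u v           ≤⟨ d-triangle u u′ v ⟩
      d u u′ + d u′ v ≡⟨ cong (_+ d u′ v) (adj⇒d≡1 h) ⟩
      suc (d u′ v)    ∎))
    where open ≤-Reasoning

  d-step : ∀ {u v k} → d u v ≡ suc k → ∃[ w ] (d u w ≡ 1 × d w v ≡ k)
  d-step {u} {v} e with towards u v
  ... | _ , inj₁ (_ , uv≡0) , _ with () ← trans (sym e) uv≡0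
  ... | w , inj₂ h , wv≡uv∸1      = w , adj⇒d≡1 h , trans wv≡uv∸1 (cong (_∸ 1) e)

  metric : Metric (Fin n)
  metric = record
    { d = d ; d-refl = d-refl ; d≡0⇒≡ = d≡0⇒≡ ; d-sym = d-sym
    ; d-triangle = d-triangle ; d-step = d-step }

  isStrongMetricGenerator⇒isResolvingSet : ∀ {S} → IsStrongMetricGenerator K S → IsResolvingSet metric (_∈ S)
  isStrongMetricGenerator⇒isResolvingSet gen u v u≢v with gen u v u≢v
  ... | w , w∈S , dwu , dwv , duv , dvu , i₁ , i₂ , i₃ , i₄ , resolves
    rewrite isDist-unique i₁ (proj₂ (dist w u)) | isDist-unique i₂ (proj₂ (dist w v))
          | isDist-unique i₃ (proj₂ (dist u v)) | isDist-unique i₄ (proj₂ (dist v u))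
    = w , w∈S , resolves

  isResolvingSet⇒isStrongMetricGenerator : ∀ {Q : Fin n → Set} {S} → IsResolvingSet metric Q →
                                           (∀ x → Q x → x ∈ S) → IsStrongMetricGenerator K S
  isResolvingSet⇒isStrongMetricGenerator gen Q⊆S u v u≢v with gen u v u≢v
  ... | w , Qw , resolves =
    w , Q⊆S w Qw ,
    d w u , d w v , d u v , d v u , proj₂ (dist w u) , proj₂ (dist w v) , proj₂ (dist u v) , proj₂ (dist v u) ,
    resolves

record IsMaxProduct {V₁ V₂ P : Set} (M₁ : Metric V₁) (M₂ : Metric V₂) (M : Metric P) : Set where
  field
    pair    : V₁ → V₂ → P
    π₁      : P → V₁
    π₂      : P → V₂
    π₁-pair : ∀ a b → π₁ (pair a b) ≡ a
    π₂-pair : ∀ a b → π₂ (pair a b) ≡ b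
    pair-π  : ∀ x → pair (π₁ x) (π₂ x) ≡ x
    d-max   : ∀ x y → Metric.d M x y ≡ Metric.d M₁ (π₁ x) (π₁ y) ⊔ Metric.d M₂ (π₂ x) (π₂ y)

isMaxProduct-swap : ∀ {V₁ V₂ P} {M₁ : Metric V₁} {M₂ : Metric V₂} {M : Metric P} →
                    IsMaxProduct M₁ M₂ M → IsMaxProduct M₂ M₁ M
isMaxProduct-swap {M₁ = M₁} product = record
  { pair = λ b a → pair a b ; π₁ = π₂ ; π₂ = π₁
  ; π₁-pair = λ b a → π₂-pair a b ; π₂-pair = λ b a → π₁-pair a b
  ; pair-π = pair-π
  ; d-max = λ x y → trans (d-max x y) (⊔-comm (Metric.d M₁ (π₁ x) (π₁ y)) _) }
  where open IsMaxProduct product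

module MaxProductProperties {V₁ V₂ P : Set} {M₁ : Metric V₁} {M₂ : Metric V₂} {M : Metric P}
                            (product : IsMaxProduct M₁ M₂ M) where
  open IsMaxProduct product
  open Metric M
  module A = Metric M₁
  module B = Metric M₂

  d-pairˡ : ∀ a b x → d (pair a b) x ≡ A.d a (π₁ x) ⊔ B.d b (π₂ x)
  d-pairˡ a b x = trans (d-max (pair a b) x)
    (cong₂ (λ a′ b′ → A.d a′ (π₁ x) ⊔ B.d b′ (π₂ x)) (π₁-pair a b) (π₂-pair a b))

  d-pair : ∀ a b c e → d (pair a b) (pair c e) ≡ A.d a c ⊔ B.d b e
  d-pair a b c e = trans (d-pairˡ a b (pair c e))
    (cong₂ (λ c′ e′ → A.d a c′ ⊔ B.d b e′) (π₁-pair c e) (π₂-pair c e))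

  d-pairʳ : ∀ x a b → d x (pair a b) ≡ A.d (π₁ x) a ⊔ B.d (π₂ x) b
  d-pairʳ x a b = trans (d-sym x (pair a b))
    (trans (d-pairˡ a b x) (cong₂ _⊔_ (A.d-sym a (π₁ x)) (B.d-sym b (π₂ x))))

  between-lift : ∀ {s x y} → B.d (π₂ y) (π₂ x) ≤ A.d (π₁ y) (π₁ x) →
                 Between M₁ s (π₁ y) (π₁ x) → Between M (pair s (π₂ y)) y x
  between-lift {s} {x} {y} dominant s-c-a = begin
    d (pair s t) x                            ≡⟨ d-pairˡ s t x ⟩
    A.d s a ⊔ B.d t b                         ≡⟨ m≥n⇒m⊔n≡m (≤-trans dominant ca≤sa) ⟩
    A.d s a                                   ≡⟨ s-c-a ⟩
    A.d s c + A.d c a                         ≡⟨ cong₂ _+_ sc≡sc⊔tt (sym (m≥n⇒m⊔n≡m dominant)) ⟩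
    (A.d s c ⊔ B.d t t) + (A.d c a ⊔ B.d t b) ≡⟨ cong₂ _+_ (d-pairˡ s t y) (d-max y x) ⟨
    d (pair s t) y + d y x                    ∎
    where
      open ≡-Reasoning
      a = π₁ x ; b = π₂ x ; c = π₁ y ; t = π₂ y
      ca≤sa : A.d c a ≤ A.d s a
      ca≤sa = subst (A.d c a ≤_) (sym s-c-a) (m≤n+m _ _)
      sc≡sc⊔tt : A.d s c ≡ A.d s c ⊔ B.d t t
      sc≡sc⊔tt = sym (trans (cong (A.d s c ⊔_) (B.d-refl t)) (⊔-identityʳ _))

  resolves-dominant : ∀ {S₁ : V₁ → Set} → IsResolvingSet M₁ S₁ → ∀ x y → x ≢ y →
                      B.d (π₂ x) (π₂ y) ≤ A.d (π₁ x) (π₁ y) → ∃[ w ] (S₁ (π₁ w) × Resolves M w x y)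
  resolves-dominant {S₁} gen x y x≢y dominant with gen (π₁ x) (π₁ y) π₁x≢π₁y
    where
      π₁x≢π₁y : π₁ x ≢ π₁ y
      π₁x≢π₁y e = x≢y (begin
        x                   ≡⟨ pair-π x ⟨
        pair (π₁ x) (π₂ x)  ≡⟨ cong₂ pair e (B.d≡0⇒≡ (n≤0⇒n≡0 (subst (B.d (π₂ x) (π₂ y) ≤_) dxy≡0 dominant))) ⟩
        pair (π₁ y) (π₂ y)  ≡⟨ pair-π y ⟩
        y                   ∎)
        where
          open ≡-Reasoning
          dxy≡0 : A.d (π₁ x) (π₁ y) ≡ 0
          dxy≡0 = trans (cong (λ c → A.d c (π₁ y)) e) (A.d-refl (π₁ y))
  ... | s , S₁s , inj₁ s-c-a =
    pair s (π₂ y) , subst S₁ (sym (π₁-pair s (π₂ y))) S₁s ,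
    inj₁ (between-lift (subst₂ _≤_ (B.d-sym _ _) (A.d-sym _ _) dominant) s-c-a)
  ... | s , S₁s , inj₂ s-a-c =
    pair s (π₂ x) , subst S₁ (sym (π₁-pair s (π₂ x))) S₁s , inj₂ (between-lift dominant s-a-c)

  maximallyDistant-pair : ∀ {a c} b → a ≢ c → MaximallyDistant M₁ a c →
                          MaximallyDistant M (pair a b) (pair c b)
  maximallyDistant-pair {a} {c} b a≢c maximal v′ cv′≡1 = begin
    d v′ (pair a b)               ≡⟨ d-pairʳ v′ a b ⟩
    A.d (π₁ v′) a ⊔ B.d (π₂ v′) b ≤⟨ ⊔-lub first second ⟩
    A.d c a                       ≡⟨ ⊔-identityʳ _ ⟨
    A.d c a ⊔ 0                   ≡⟨ cong (A.d c a ⊔_) (B.d-refl b) ⟨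
    A.d c a ⊔ B.d b b             ≡⟨ d-pair c b a b ⟨
    d (pair c b) (pair a b)       ∎
    where
      open ≤-Reasoning
      open MetricProperties M₁ using (≢⇒1≤d; d≤1⇒≡⊎d≡1)
      step≡1 : A.d c (π₁ v′) ⊔ B.d b (π₂ v′) ≡ 1
      step≡1 = trans (sym (d-pairˡ c b v′)) cv′≡1
      first : A.d (π₁ v′) a ≤ A.d c a
      first with d≤1⇒≡⊎d≡1 (subst (A.d c (π₁ v′) ≤_) step≡1 (m≤m⊔n _ _))
      ... | inj₁ refl = ≤-refl
      ... | inj₂ cc′≡1 = maximal (π₁ v′) cc′≡1
      second : B.d (π₂ v′) b ≤ A.d c a
      second = ≤-trans (subst (_≤ 1) (B.d-sym b (π₂ v′)) (subst (B.d b (π₂ v′) ≤_) step≡1 (m≤n⊔m _ _)))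
                       (≢⇒1≤d (a≢c ∘ sym))

isResolvingSet-product : ∀ {V₁ V₂ P} {M₁ : Metric V₁} {M₂ : Metric V₂} {M : Metric P} →
  (product : IsMaxProduct M₁ M₂ M) → let open IsMaxProduct product in
  ∀ {S₁ S₂} → IsResolvingSet M₁ S₁ → IsResolvingSet M₂ S₂ →
  IsResolvingSet M (λ x → S₁ (π₁ x) ⊎ S₂ (π₂ x))
isResolvingSet-product {M₁ = M₁} {M₂} product gen₁ gen₂ x y x≢y
  with ≤-total (Metric.d M₂ (π₂ x) (π₂ y)) (Metric.d M₁ (π₁ x) (π₁ y))
  where open IsMaxProduct product
... | inj₁ dominant₁
  with w , S₁w , r ← MaxProductProperties.resolves-dominant product gen₁ x y x≢y dominant₁
  = w , inj₁ S₁w , r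
... | inj₂ dominant₂
  with w , S₂w , r ← MaxProductProperties.resolves-dominant (isMaxProduct-swap product) gen₂ x y x≢y dominant₂
  = w , inj₂ S₂w , r

-- A mutually maximally distant pair (a, c) of the slice can only be resolved in the
-- product by (a, b) or (c, b); resolution then spreads to all pairs of the slice.
isResolvingSet-slice : ∀ {n V₂ P} {M₁ : Metric (Fin n)} {M₂ : Metric V₂} {M : Metric P} →
  (product : IsMaxProduct M₁ M₂ M) → let open IsMaxProduct product in
  ∀ {W} → IsResolvingSet M W → ∀ b → IsResolvingSet M₁ (λ a → W (pair a b))
isResolvingSet-slice {M₁ = M₁} {M = M} product {W} gen b =
  FiniteMetric.mutuallyMaximal-induction M₁ ResolvedInSlice
    (λ (x , Wx , r) → x , Wx , Sum.swap r)
    (λ far (x , Wx , r) → x , Wx , MetricProperties.resolves-farther M₁ far r)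
    maximal
  where
    open IsMaxProduct product
    open Metric M₁
    open MaxProductProperties product using (maximallyDistant-pair)
    open MetricProperties M using (between-maximallyDistant)

    ResolvedInSlice : Fin _ → Fin _ → Set
    ResolvedInSlice a c = ∃[ x ] (W (pair x b) × Resolves M₁ x a c)

    maximal : ∀ {a c} → a ≢ c → MaximallyDistant M₁ c a → MaximallyDistant M₁ a c → ResolvedInSlice a c
    maximal {a} {c} a≢c a-maximal c-maximal
      with gen (pair a b) (pair c b) (λ e → a≢c (trans (sym (π₁-pair a b)) (trans (cong π₁ e) (π₁-pair c b))))
    ... | w , Ww , inj₁ w-cb-ab =
      c , subst W (between-maximallyDistant (maximallyDistant-pair b a≢c c-maximal) w-cb-ab) Ww ,
      inj₁ (cong (_+ d c a) (sym (d-refl c)))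
    ... | w , Ww , inj₂ w-ab-cb =
      a , subst W (between-maximallyDistant (maximallyDistant-pair b (a≢c ∘ sym) a-maximal) w-ab-cb) Ww ,
      inj₂ (cong (_+ d a c) (sym (d-refl a)))

module Coordinates (m n : ℕ) where

  π₁ : Fin (m * n) → Fin m
  π₁ x = proj₁ (remQuot {m} n x)

  π₂ : Fin (m * n) → Fin n
  π₂ x = proj₂ (remQuot {m} n x)

  _⊠ˢ_ : Subset m → Subset n → Subset (m * n)
  S₁ ⊠ˢ S₂ = tabulate (λ x → lookup S₁ (π₁ x) ∨ lookup S₂ (π₂ x))

  ∈⊠ˢ : ∀ {S₁ S₂ x} → π₁ x ∈ S₁ ⊎ π₂ x ∈ S₂ → x ∈ S₁ ⊠ˢ S₂
  ∈⊠ˢ {S₁} {S₂} {x} (inj₁ π₁x∈S₁) = ∈-tabulate _ (cong (_∨ lookup S₂ (π₂ x)) ([]=⇒lookup π₁x∈S₁))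
  ∈⊠ˢ {S₁} {S₂} {x} (inj₂ π₂x∈S₂) =
    ∈-tabulate _ (trans (cong (lookup S₁ (π₁ x) ∨_) ([]=⇒lookup π₂x∈S₂)) (∨-zeroʳ _))

  sliceˡ : Subset (m * n) → Fin n → Subset m
  sliceˡ W j = tabulate (λ i → lookup W (combine i j))

  sliceʳ : Subset (m * n) → Fin m → Subset n
  sliceʳ W i = tabulate (λ j → lookup W (combine i j))

  ∣W∣≡∑∑ : (W : Subset (m * n)) → ∣ W ∣ ≡ ∑[ i < m ] ∑[ j < n ] 𝟙 (lookup W (combine i j))
  ∣W∣≡∑∑ W = trans (∣p∣≡∑𝟙 W) (∑-combine m {n} (𝟙 ∘ lookup W))

  ∑∣sliceʳ∣ : (W : Subset (m * n)) → ∑[ i < m ] ∣ sliceʳ W i ∣ ≡ ∣ W ∣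
  ∑∣sliceʳ∣ W =
    trans (sum-cong-≗ (λ (i : Fin m) → ∣tabulate∣ (λ (j : Fin n) → lookup W (combine i j)))) (sym (∣W∣≡∑∑ W))

  ∑∣sliceˡ∣ : (W : Subset (m * n)) → ∑[ j < n ] ∣ sliceˡ W j ∣ ≡ ∣ W ∣
  ∑∣sliceˡ∣ W = begin
    ∑[ j < n ] ∣ sliceˡ W j ∣
      ≡⟨ sum-cong-≗ (λ j → ∣tabulate∣ (λ (i : Fin m) → lookup W (combine i j))) ⟩
    ∑[ j < n ] ∑[ i < m ] 𝟙 (lookup W (combine i j))
      ≡⟨ ∑-comm (λ (i : Fin m) (j : Fin n) → 𝟙 (lookup W (combine i j))) ⟨
    ∑[ i < m ] ∑[ j < n ] 𝟙 (lookup W (combine i j))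
      ≡⟨ ∣W∣≡∑∑ W ⟨
    ∣ W ∣ ∎
    where open ≡-Reasoning

  sliceˡ-bound : ∀ {k} (W : Subset (m * n)) → (∀ j → k ≤ ∣ sliceˡ W j ∣) → n * k ≤ ∣ W ∣
  sliceˡ-bound {k} W k≤∣slice∣ = begin
    n * k                     ≡⟨ ∑-const n k ⟨
    ∑[ j < n ] k              ≤⟨ ∑-mono-≤ k≤∣slice∣ ⟩
    ∑[ j < n ] ∣ sliceˡ W j ∣ ≡⟨ ∑∣sliceˡ∣ W ⟩
    ∣ W ∣                     ∎
    where open ≤-Reasoning

  sliceʳ-bound : ∀ {k} (W : Subset (m * n)) → (∀ i → k ≤ ∣ sliceʳ W i ∣) → m * k ≤ ∣ W ∣
  sliceʳ-bound {k} W k≤∣slice∣ = begin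
    m * k                     ≡⟨ ∑-const m k ⟨
    ∑[ i < m ] k              ≤⟨ ∑-mono-≤ k≤∣slice∣ ⟩
    ∑[ i < m ] ∣ sliceʳ W i ∣ ≡⟨ ∑∣sliceʳ∣ W ⟩
    ∣ W ∣                     ∎
    where open ≤-Reasoning

  ∣⊠ˢ∣ : (S₁ : Subset m) (S₂ : Subset n) → ∣ S₁ ⊠ˢ S₂ ∣ + ∣ S₁ ∣ * ∣ S₂ ∣ ≡ n * ∣ S₁ ∣ + m * ∣ S₂ ∣
  ∣⊠ˢ∣ S₁ S₂ = begin
    ∣ S₁ ⊠ˢ S₂ ∣ + ∣ S₁ ∣ * ∣ S₂ ∣
      ≡⟨ cong₂ (λ p q → ∣ S₁ ⊠ˢ S₂ ∣ + p * q) (∣p∣≡∑𝟙 S₁) (∣p∣≡∑𝟙 S₂) ⟩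
    ∣ S₁ ⊠ˢ S₂ ∣ + P * Q
      ≡⟨ cong (_+ P * Q) (trans (∣W∣≡∑∑ (S₁ ⊠ˢ S₂)) (sum-cong-≗ (λ i → sum-cong-≗ (λ j → cong 𝟙 (entry i j))))) ⟩
    ∑[ i < m ] ∑[ j < n ] 𝟙 (lookup S₁ i ∨ lookup S₂ j) + P * Q
      ≡⟨ ∑∑-∨ (lookup S₁) (lookup S₂) ⟩
    n * P + m * Q
      ≡⟨ cong₂ (λ p q → n * p + m * q) (∣p∣≡∑𝟙 S₁) (∣p∣≡∑𝟙 S₂) ⟨
    n * ∣ S₁ ∣ + m * ∣ S₂ ∣ ∎
    where
      open ≡-Reasoning
      P = ∑[ i < m ] 𝟙 (lookup S₁ i)
      Q = ∑[ j < n ] 𝟙 (lookup S₂ j)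
      entry : ∀ i j → lookup (S₁ ⊠ˢ S₂) (combine i j) ≡ lookup S₁ i ∨ lookup S₂ j
      entry i j = trans (lookup∘tabulate _ (combine i j))
        (cong (λ (i′ , j′) → lookup S₁ i′ ∨ lookup S₂ j′) (remQuot-combine i j))

module StrongProduct {n₁ n₂ : ℕ} (G : Graph n₁) (H : Graph n₂)
                     (distG : HasDistances G) (distH : HasDistances H) where
  open Coordinates n₁ n₂ public
  module Gᵈ = GraphMetric G distG
  module Hᵈ = GraphMetric H distH

  d⊠ : Fin (n₁ * n₂) → Fin (n₁ * n₂) → ℕ
  d⊠ x y = Gᵈ.d (π₁ x) (π₁ y) ⊔ Hᵈ.d (π₂ x) (π₂ y)

  adj⇒d≤1 : ∀ {x y} → StrongAdj G H x y → Gᵈ.d (π₁ x) (π₁ y) ≤ 1 × Hᵈ.d (π₂ x) (π₂ y) ≤ 1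
  adj⇒d≤1 {x} (inj₁ (e , h)) =
    subst (λ a → Gᵈ.d (π₁ x) a ≤ 1) e (subst (_≤ 1) (sym (Gᵈ.d-refl (π₁ x))) z≤n) , ≤-reflexive (Hᵈ.adj⇒d≡1 h)
  adj⇒d≤1 {x} (inj₂ (inj₁ (g , e))) =
    ≤-reflexive (Gᵈ.adj⇒d≡1 g) , subst (λ b → Hᵈ.d (π₂ x) b ≤ 1) e (subst (_≤ 1) (sym (Hᵈ.d-refl (π₂ x))) z≤n)
  adj⇒d≤1 (inj₂ (inj₂ (g , h))) = ≤-reflexive (Gᵈ.adj⇒d≡1 g) , ≤-reflexive (Hᵈ.adj⇒d≡1 h)

  d⊠≤length : ∀ {x y m} → Walk (G ⊠ H) x y m → d⊠ x y ≤ m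
  d⊠≤length {x} nil = ≤-reflexive (cong₂ _⊔_ (Gᵈ.d-refl (π₁ x)) (Hᵈ.d-refl (π₂ x)))
  d⊠≤length {x} {y} (cons {w = z} h rest) with xz₁≤1 , xz₂≤1 ← adj⇒d≤1 h = ⊔-lub
    (≤-trans (Gᵈ.d-triangle (π₁ x) (π₁ z) (π₁ y)) (+-mono-≤ xz₁≤1 (≤-trans (m≤m⊔n _ _) (d⊠≤length rest))))
    (≤-trans (Hᵈ.d-triangle (π₂ x) (π₂ z) (π₂ y)) (+-mono-≤ xz₂≤1 (≤-trans (m≤n⊔m _ _) (d⊠≤length rest))))

  adj-combine : ∀ {a b c e} → (a ≡ c × Adj H b e) ⊎ (Adj G a c × b ≡ e) ⊎ (Adj G a c × Adj H b e) →
                StrongAdj G H (combine a b) (combine c e)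
  adj-combine {a} {b} {c} {e} = subst₂ ProductAdj (sym (remQuot-combine a b)) (sym (remQuot-combine c e))
    where
      ProductAdj : Fin n₁ × Fin n₂ → Fin n₁ × Fin n₂ → Set
      ProductAdj (a , b) (c , e) = (a ≡ c × Adj H b e) ⊎ (Adj G a c × b ≡ e) ⊎ (Adj G a c × Adj H b e)

  -- Step both coordinates along shortest walks simultaneously (a coordinate already at its target stays).
  d⊠-walk : ∀ k a b c e → Gᵈ.d a c ⊔ Hᵈ.d b e ≡ k → Walk (G ⊠ H) (combine a b) (combine c e) k
  d⊠-walk zero a b c e d≡0 with Gᵈ.d≡0⇒≡ (n≤0⇒n≡0 (≤-trans (m≤m⊔n _ _) (≤-reflexive d≡0)))
                               | Hᵈ.d≡0⇒≡ (n≤0⇒n≡0 (≤-trans (m≤n⊔m _ _) (≤-reflexive d≡0)))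
  ... | refl | refl = nil
  d⊠-walk (suc k) a b c e d≡1+k
    with a′ , a′-step , a′c≡ ← Gᵈ.towards a c | b′ , b′-step , b′e≡ ← Hᵈ.towards b e
    = cons (edge a′-step b′-step) (d⊠-walk k a′ b′ c e (begin
        Gᵈ.d a′ c ⊔ Hᵈ.d b′ e               ≡⟨ cong₂ _⊔_ a′c≡ b′e≡ ⟩
        (Gᵈ.d a c ∸ 1) ⊔ (Hᵈ.d b e ∸ 1)     ≡⟨ ∸-distribʳ-⊔ 1 (Gᵈ.d a c) (Hᵈ.d b e) ⟨
        (Gᵈ.d a c ⊔ Hᵈ.d b e) ∸ 1           ≡⟨ cong (_∸ 1) d≡1+k ⟩
        k                                   ∎))
    where
      open ≡-Reasoning
      edge : ∀ {a′ b′} → (a′ ≡ a × Gᵈ.d a c ≡ 0 ⊎ Adj G a a′) → (b′ ≡ b × Hᵈ.d b e ≡ 0 ⊎ Adj H b b′) →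
             StrongAdj G H (combine a b) (combine a′ b′)
      edge (inj₁ (refl , ac≡0)) (inj₁ (refl , be≡0)) with () ← trans (sym d≡1+k) (cong₂ _⊔_ ac≡0 be≡0)
      edge (inj₁ (refl , _)) (inj₂ h) = adj-combine (inj₁ (refl , h))
      edge (inj₂ g) (inj₁ (refl , _)) = adj-combine (inj₂ (inj₁ (g , refl)))
      edge (inj₂ g) (inj₂ h)          = adj-combine (inj₂ (inj₂ (g , h)))

  distances : HasDistances (G ⊠ H)
  distances x y = d⊠ x y , walk , λ _ → d⊠≤length
    where
      walk : Walk (G ⊠ H) x y (d⊠ x y)
      walk = subst₂ (λ x′ y′ → Walk (G ⊠ H) x′ y′ (d⊠ x y))
                    (combine-remQuot {n₁} n₂ x) (combine-remQuot {n₁} n₂ y)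
                    (d⊠-walk (d⊠ x y) (π₁ x) (π₂ x) (π₁ y) (π₂ y) refl)

  module ⊠ᵈ = GraphMetric (G ⊠ H) distances

  isMaxProduct : IsMaxProduct Gᵈ.metric Hᵈ.metric ⊠ᵈ.metric
  isMaxProduct = record
    { pair = combine ; π₁ = π₁ ; π₂ = π₂
    ; π₁-pair = λ a b → cong proj₁ (remQuot-combine a b)
    ; π₂-pair = λ a b → cong proj₂ (remQuot-combine a b)
    ; pair-π = combine-remQuot {n₁} n₂
    ; d-max = λ _ _ → refl }

  ⊠ˢ-isStrongMetricGenerator : ∀ {S₁ S₂} → IsStrongMetricGenerator G S₁ → IsStrongMetricGenerator H S₂ →
                               IsStrongMetricGenerator (G ⊠ H) (S₁ ⊠ˢ S₂)
  ⊠ˢ-isStrongMetricGenerator gen₁ gen₂ =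
    ⊠ᵈ.isResolvingSet⇒isStrongMetricGenerator
      (isResolvingSet-product isMaxProduct
        (Gᵈ.isStrongMetricGenerator⇒isResolvingSet gen₁) (Hᵈ.isStrongMetricGenerator⇒isResolvingSet gen₂))
      (λ _ → ∈⊠ˢ)

  sliceˡ-isStrongMetricGenerator : ∀ {W} → IsStrongMetricGenerator (G ⊠ H) W →
                                   ∀ j → IsStrongMetricGenerator G (sliceˡ W j)
  sliceˡ-isStrongMetricGenerator gen j =
    Gᵈ.isResolvingSet⇒isStrongMetricGenerator
      (isResolvingSet-slice isMaxProduct (⊠ᵈ.isStrongMetricGenerator⇒isResolvingSet gen) j)
      (λ _ → ∈-tabulate _ ∘ []=⇒lookup)

  sliceʳ-isStrongMetricGenerator : ∀ {W} → IsStrongMetricGenerator (G ⊠ H) W →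
                                   ∀ i → IsStrongMetricGenerator H (sliceʳ W i)
  sliceʳ-isStrongMetricGenerator gen i =
    Hᵈ.isResolvingSet⇒isStrongMetricGenerator
      (isResolvingSet-slice (isMaxProduct-swap isMaxProduct) (⊠ᵈ.isStrongMetricGenerator⇒isResolvingSet gen) i)
      (λ _ → ∈-tabulate _ ∘ []=⇒lookup)

theorem13 : ∀ {n₁ n₂} (G : Graph n₁) (H : Graph n₂) →
    2 ≤ n₁ → 2 ≤ n₂ → Connected G → Connected H →
    ∀ (a b c : ℕ) → IsStrongMetricDim G a → IsStrongMetricDim H b →
    IsStrongMetricDim (G ⊠ H) c →
    ((n₂ * a) ⊔ (n₁ * b) ≤ c) × (c + a * b ≤ n₂ * a + n₁ * b)
theorem13 {n₁} {n₂} G H _ _ _ _ _ _ _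
          ((S₁ , gen₁ , refl) , minimal₁) ((S₂ , gen₂ , refl) , minimal₂) ((W , gen , refl) , minimal) =
  ⊔-lub (sliceˡ-bound W λ j → minimal₁ _ (sliceˡ-isStrongMetricGenerator gen j))
        (sliceʳ-bound W λ i → minimal₂ _ (sliceʳ-isStrongMetricGenerator gen i)) ,
  (begin
    ∣ W ∣ + ∣ S₁ ∣ * ∣ S₂ ∣        ≤⟨ +-monoˡ-≤ _ (minimal _ (⊠ˢ-isStrongMetricGenerator gen₁ gen₂)) ⟩
    ∣ S₁ ⊠ˢ S₂ ∣ + ∣ S₁ ∣ * ∣ S₂ ∣ ≡⟨ ∣⊠ˢ∣ S₁ S₂ ⟩
    n₂ * ∣ S₁ ∣ + n₁ * ∣ S₂ ∣      ∎)
  where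
    open ≤-Reasoning
    open StrongProduct G H (isStrongMetricGenerator⇒hasDistances gen₁) (isStrongMetricGenerator⇒hasDistances gen₂)
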